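{- Let $A$ be the adjacency matrix of a regular tournament $T$ of order $h$ (so $h$ is odd), and let $$D=D(T)=\begin{bmatrix} 0 & \mathbf 1^T & 0 & \mathbf 0^T\\ \mathbf 0 & A & \mathbf 1 & A^T\\ 0 & \mathbf 0^T & 0 & \mathbf 1^T\\ \mathbf 1 & A^T & \mathbf 0 & A\end{bmatrix},$$ where $\mathbf 0,\mathbf 1$ denote the all-zeros and all-ones column vectors of length $h$. Then $$M(D)=\begin{bmatrix} D & D^T+I\\ D+I & D^T\end{bmatrix}$$ (with $I$ the identity of order $2h+2$) is the adjacency matrix of a directed strongly regular graph with parameters $(4(h+1),\,2h+1,\,h+1,\,h,\,h)$.
   Context: A tournament is a directed graph without loops in which for every pair of distinct vertices $x,y$ exactly one of the arcs $x\to y$, $y\to x$ is present; its $0/1$ adjacency matrix $A$ satisfies $A+A^T=J-I$. It is regular if all out-degrees are equal. A directed strongly regular graph with parameters $(n,k,t,\lambda,\mu)$ is a directed graph on $n$ vertices (no loops, no multiple arcs) whose $0/1$ adjacency matrix $M$ satisfies $M^2=tI+\lambda M+\mu(J-I-M)$ and $MJ=JM=kJ$, where $I$ is the identity and $J$ the all-ones matrix of order $n$. -}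

module Defs where

open import Data.Nat using (ℕ; zero; suc; _+_; _*_; _∸_)
open import Data.Nat.Properties using (+-suc; *-comm; +-assoc)
open import Data.Fin using (Fin; zero; suc; splitAt; cast)
open import Data.Sum using (_⊎_; inj₁; inj₂)
open import Data.Product using (∃)
open import Relation.Binary.PropositionalEquality using (_≡_; refl; sym; trans; cong)
open import Relation.Nullary using (¬_)

Mat : ℕ → Set
Mat n = Fin n → Fin n → ℕ

Σ[<_]_ : (n : ℕ) → (Fin n → ℕ) → ℕ
Σ[< zero ] f = 0
Σ[< suc n ] f = f zero + Σ[< n ] (λ i → f (suc i))

δ : ∀ {n} → Fin n → Fin n → ℕ
δ zero zero = 1
δ zero (suc j) = 0
δ (suc i) zero = 0
δ (suc i) (suc j) = δ i j

I : ∀ {n} → Mat n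
I = δ

J : ∀ {n} → Mat n
J _ _ = 1

_ᵀ : ∀ {n} → Mat n → Mat n
(M ᵀ) i j = M j i

_·_ : ∀ {n} → Mat n → Mat n → Mat n
_·_ {n} M N i j = Σ[< n ] (λ l → M i l * N l j)

_⊕_ : ∀ {n} → Mat n → Mat n → Mat n
(M ⊕ N) i j = M i j + N i j

ZeroOne : ∀ {n} → Mat n → Set
ZeroOne M = ∀ i j → (M i j ≡ 0) ⊎ (M i j ≡ 1)

IsTournament : ∀ {h} → Mat h → Set
IsTournament A = ZeroOne A × (∀ i j → A i j + A j i ≡ 1 ∸ δ i j)
  where open import Data.Product using (_×_)

IsRegular : ∀ {h} → Mat h → Set
IsRegular {h} A = ∃ λ k → ∀ i → Σ[< h ] (λ j → A i j) ≡ k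

record IsDSRG (n k t λ' μ : ℕ) (M : Mat n) : Set where
  field
    zeroOne : ZeroOne M
    noLoops : ∀ i → M i i ≡ 0
    square  : ∀ i j → (M · M) i j ≡ t * δ i j + λ' * M i j + μ * ((1 ∸ δ i j) ∸ M i j)
    rowSum  : ∀ i → Σ[< n ] (λ j → M i j) ≡ k
    colSum  : ∀ j → Σ[< n ] (λ i → M i j) ≡ k

-- The matrix D(T), of order (1 + h) + (1 + h), with block rows/columns
-- of sizes 1, h, 1, h (in that order).
D : ∀ {h} → Mat h → Mat (suc h + suc h)
D {h} A i j with splitAt (suc h) i | splitAt (suc h) j
... | inj₁ zero    | inj₁ zero    = 0
... | inj₁ zero    | inj₁ (suc b) = 1
... | inj₁ zero    | inj₂ zero    = 0
... | inj₁ zero    | inj₂ (suc b) = 0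
... | inj₁ (suc a) | inj₁ zero    = 0
... | inj₁ (suc a) | inj₁ (suc b) = A a b
... | inj₁ (suc a) | inj₂ zero    = 1
... | inj₁ (suc a) | inj₂ (suc b) = A b a
... | inj₂ zero    | inj₁ zero    = 0
... | inj₂ zero    | inj₁ (suc b) = 0
... | inj₂ zero    | inj₂ zero    = 0
... | inj₂ zero    | inj₂ (suc b) = 1
... | inj₂ (suc a) | inj₁ zero    = 1
... | inj₂ (suc a) | inj₁ (suc b) = A b a
... | inj₂ (suc a) | inj₂ zero    = 0
... | inj₂ (suc a) | inj₂ (suc b) = A a b

MD : ∀ {m} → Mat m → Mat (m + m)
MD {m} Dm i j with splitAt m i | splitAt m j
... | inj₁ a | inj₁ b = Dm a b
... | inj₁ a | inj₂ b = Dm b a + δ a b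
... | inj₂ a | inj₁ b = Dm a b + δ a b
... | inj₂ a | inj₂ b = Dm b a

order-eq : ∀ h → 4 * suc h ≡ (suc h + suc h) + (suc h + suc h)
order-eq h = +-*-Solver.solve 1 (λ x → con 4 :* x := (x :+ x) :+ (x :+ x)) refl (suc h)
  where open import Data.Nat.Solver using (module +-*-Solver)
        open +-*-Solver

M4 : ∀ {h} → Mat h → Mat (4 * suc h)
M4 {h} A i j = MD (D A) (cast (order-eq h) i) (cast (order-eq h) j)

-- D = D(T) satisfies D + Dᵀ + I + P = J, where P is the permutation matrix of the involution
-- exchanging the two halves of the index set; P sends out-neighbourhoods to in-neighbourhoods
-- (PD = Dᵀ = DP), and D has constant row and column sums h. Multiplying M = M(D) out blockwise,
-- each block of M² collapses by means of these identities, e.g.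
--   D² + (Dᵀ + I)(D + I) = (D + Dᵀ + I)D + Dᵀ + I = (J − P)D + Dᵀ + I = hJ + I,
-- so M² = I + hJ, which is the DSRG equation for t = h + 1 and λ = μ = h.
module Submission where

open import Defs
open import Data.Nat using (ℕ; zero; suc; _+_; _*_; _∸_; _≤_; s≤s; z≤n)
open import Data.Nat.Properties
  using (+-assoc; +-identityʳ; *-identityˡ; *-identityʳ; *-comm; *-distribʳ-+; suc-injective;
         m≤m+n; m≤n+m; ≤-trans; n≤1⇒n≡0∨n≡1; m+n≡0⇒m≡0; m+n≡0⇒n≡0; m∸n+n≡m)
open import Data.Nat.Solver using (module +-*-Solver)
open import Data.Fin using (Fin; zero; suc; splitAt; join; cast; _↑ˡ_; _↑ʳ_)
open import Data.Fin.Properties using (splitAt-join; join-splitAt)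
open import Data.Sum using (_⊎_; inj₁; inj₂; swap)
open import Data.Sum.Properties using (swap-involutive)
open import Data.Product using (proj₂)
open import Function using (_∘_)
open import Relation.Binary.PropositionalEquality

open +-*-Solver using (solve; _:=_; _:+_; _:*_; con)

Σ-cong : ∀ {n} {f g : Fin n → ℕ} → (∀ i → f i ≡ g i) → Σ[< n ] f ≡ Σ[< n ] g
Σ-cong {zero}  f≗g = refl
Σ-cong {suc n} f≗g = cong₂ _+_ (f≗g zero) (Σ-cong (f≗g ∘ suc))

Σ-distrib-+ : ∀ {n} (f g : Fin n → ℕ) →
              Σ[< n ] (λ i → f i + g i) ≡ Σ[< n ] f + Σ[< n ] g
Σ-distrib-+ {zero}  f g = refl
Σ-distrib-+ {suc n} f g =
  trans (cong (f zero + g zero +_) (Σ-distrib-+ (f ∘ suc) (g ∘ suc)))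
        (solve 4 (λ a b c d → (a :+ b) :+ (c :+ d) := (a :+ c) :+ (b :+ d))
               refl (f zero) (g zero) _ _)

Σ-zero : ∀ n → Σ[< n ] (λ _ → 0) ≡ 0
Σ-zero zero    = refl
Σ-zero (suc n) = Σ-zero n

Σ-one : ∀ n → Σ[< n ] (λ _ → 1) ≡ n
Σ-one zero    = refl
Σ-one (suc n) = cong suc (Σ-one n)

Σ-split : ∀ m n (f : Fin (m + n) → ℕ) →
          Σ[< m + n ] f ≡ Σ[< m ] (λ i → f (i ↑ˡ n)) + Σ[< n ] (λ i → f (m ↑ʳ i))
Σ-split zero    n f = refl
Σ-split (suc m) n f =
  trans (cong (f zero +_) (Σ-split m n (f ∘ suc))) (sym (+-assoc (f zero) _ _))

Σ-cast : ∀ {n n′} (e : n ≡ n′) (f : Fin n′ → ℕ) → Σ[< n ] (f ∘ cast e) ≡ Σ[< n′ ] f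
Σ-cast {zero}  {zero}   e f = refl
Σ-cast {suc n} {suc n′} e f = cong (f zero +_) (Σ-cast (suc-injective e) (f ∘ suc))

δ-refl : ∀ {n} (a : Fin n) → δ a a ≡ 1
δ-refl zero    = refl
δ-refl (suc a) = δ-refl a

δ-comm : ∀ {n} (a b : Fin n) → δ a b ≡ δ b a
δ-comm zero    zero    = refl
δ-comm zero    (suc b) = refl
δ-comm (suc a) zero    = refl
δ-comm (suc a) (suc b) = δ-comm a b

δ≤1 : ∀ {n} (a b : Fin n) → δ a b ≤ 1
δ≤1 zero    zero    = s≤s z≤n
δ≤1 zero    (suc b) = z≤n
δ≤1 (suc a) zero    = z≤n
δ≤1 (suc a) (suc b) = δ≤1 a b

δ≡0∨1 : ∀ {n} (a b : Fin n) → δ a b ≡ 0 ⊎ δ a b ≡ 1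
δ≡0∨1 a b = n≤1⇒n≡0∨n≡1 (δ≤1 a b)

δ≡1⇒≡ : ∀ {n} {a b : Fin n} → δ a b ≡ 1 → a ≡ b
δ≡1⇒≡ {a = zero}  {zero}  _ = refl
δ≡1⇒≡ {a = suc a} {suc b} e = cong suc (δ≡1⇒≡ e)

δ-cast : ∀ {n n′} (e : n ≡ n′) (a b : Fin n) → δ (cast e a) (cast e b) ≡ δ a b
δ-cast {suc n} {suc n′} e zero    zero    = refl
δ-cast {suc n} {suc n′} e zero    (suc b) = refl
δ-cast {suc n} {suc n′} e (suc a) zero    = refl
δ-cast {suc n} {suc n′} e (suc a) (suc b) = δ-cast (suc-injective e) a b

δ-↑ˡ : ∀ {m} n (a b : Fin m) → δ (a ↑ˡ n) (b ↑ˡ n) ≡ δ a b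
δ-↑ˡ n zero    zero    = refl
δ-↑ˡ n zero    (suc b) = refl
δ-↑ˡ n (suc a) zero    = refl
δ-↑ˡ n (suc a) (suc b) = δ-↑ˡ n a b

δ-↑ʳ : ∀ {n} m (a b : Fin n) → δ (m ↑ʳ a) (m ↑ʳ b) ≡ δ a b
δ-↑ʳ zero    a b = refl
δ-↑ʳ (suc m) a b = δ-↑ʳ m a b

δ-↑ˡ-↑ʳ : ∀ {m n} (a : Fin m) (b : Fin n) → δ (a ↑ˡ n) (m ↑ʳ b) ≡ 0
δ-↑ˡ-↑ʳ zero    b = refl
δ-↑ˡ-↑ʳ (suc a) b = δ-↑ˡ-↑ʳ a b

δ-↑ʳ-↑ˡ : ∀ {m n} (a : Fin m) (b : Fin n) → δ (m ↑ʳ b) (a ↑ˡ n) ≡ 0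
δ-↑ʳ-↑ˡ zero    b = refl
δ-↑ʳ-↑ˡ (suc a) b = δ-↑ʳ-↑ˡ a b

Σ-δˡ : ∀ {n} (a : Fin n) (f : Fin n → ℕ) → Σ[< n ] (λ z → δ a z * f z) ≡ f a
Σ-δˡ {suc n} zero    f =
  trans (cong₂ _+_ (+-identityʳ (f zero)) (Σ-zero n)) (+-identityʳ (f zero))
Σ-δˡ {suc n} (suc a) f = Σ-δˡ a (f ∘ suc)

Σ-δʳ : ∀ {n} (a : Fin n) (f : Fin n → ℕ) → Σ[< n ] (λ z → f z * δ z a) ≡ f a
Σ-δʳ a f = trans (Σ-cong (λ z → trans (*-comm (f z) _) (cong (_* f z) (δ-comm z a))))
                 (Σ-δˡ a f)

Σ-δ : ∀ {n} (a : Fin n) → Σ[< n ] (δ a) ≡ 1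
Σ-δ a = trans (Σ-cong (λ z → sym (*-identityʳ (δ a z)))) (Σ-δˡ a (λ _ → 1))

Σ-δᵀ : ∀ {n} (a : Fin n) → Σ[< n ] (λ z → δ z a) ≡ 1
Σ-δᵀ a = trans (Σ-cong (λ z → δ-comm z a)) (Σ-δ a)

Σ-complement : ∀ {n} (r : Fin n → ℕ) (p : Fin n) (f : Fin n → ℕ) →
               (∀ z → r z + δ p z ≡ 1) → Σ[< n ] (λ z → r z * f z) + f p ≡ Σ[< n ] f
Σ-complement {n} r p f r+δ≡1 = begin
  Σ[< n ] (λ z → r z * f z) + f p
    ≡⟨ cong (_ +_) (sym (Σ-δˡ p f)) ⟩
  Σ[< n ] (λ z → r z * f z) + Σ[< n ] (λ z → δ p z * f z)
    ≡⟨ sym (Σ-distrib-+ (λ z → r z * f z) (λ z → δ p z * f z)) ⟩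
  Σ[< n ] (λ z → r z * f z + δ p z * f z)
    ≡⟨ Σ-cong (λ z → sym (*-distribʳ-+ (f z) (r z) (δ p z))) ⟩
  Σ[< n ] (λ z → (r z + δ p z) * f z)
    ≡⟨ Σ-cong (λ z → trans (cong (_* f z) (r+δ≡1 z)) (*-identityˡ (f z))) ⟩
  Σ[< n ] f ∎
  where open ≡-Reasoning

Σ-collectʳ : ∀ {n} (a b c e : Fin n → ℕ) →
             Σ[< n ] (λ z → a z * c z) + Σ[< n ] (λ z → b z * (c z + e z))
             ≡ Σ[< n ] (λ z → (a z + b z) * c z) + Σ[< n ] (λ z → b z * e z)
Σ-collectʳ a b c e =
  trans (sym (Σ-distrib-+ (λ z → a z * c z) (λ z → b z * (c z + e z))))
  (trans (Σ-cong (λ z → solve 4 (λ a b c e → a :* c :+ b :* (c :+ e) := (a :+ b) :* c :+ b :* e)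
                                refl (a z) (b z) (c z) (e z)))
         (Σ-distrib-+ (λ z → (a z + b z) * c z) (λ z → b z * e z)))

Σ-collectˡ : ∀ {n} (a b c e : Fin n → ℕ) →
             Σ[< n ] (λ z → a z * (c z + e z)) + Σ[< n ] (λ z → b z * c z)
             ≡ Σ[< n ] (λ z → (a z + b z) * c z) + Σ[< n ] (λ z → a z * e z)
Σ-collectˡ a b c e =
  trans (sym (Σ-distrib-+ (λ z → a z * (c z + e z)) (λ z → b z * c z)))
  (trans (Σ-cong (λ z → solve 4 (λ a b c e → a :* (c :+ e) :+ b :* c := (a :+ b) :* c :+ a :* e)
                                refl (a z) (b z) (c z) (e z)))
         (Σ-distrib-+ (λ z → (a z + b z) * c z) (λ z → a z * e z)))

data Halves (m n : ℕ) : Fin (m + n) → Set where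
  left  : (x : Fin m) → Halves m n (x ↑ˡ n)
  right : (y : Fin n) → Halves m n (m ↑ʳ y)

halves : ∀ m n (i : Fin (m + n)) → Halves m n i
halves m n i = subst (Halves m n) (join-splitAt m n i) (fromSplit (splitAt m i))
  where
  fromSplit : (s : Fin m ⊎ Fin n) → Halves m n (join m n s)
  fromSplit (inj₁ x) = left x
  fromSplit (inj₂ y) = right y

module _ {m : ℕ} (M : Mat m) where

  MD-↑ˡ-↑ˡ : ∀ x y → MD M (x ↑ˡ m) (y ↑ˡ m) ≡ M x y
  MD-↑ˡ-↑ˡ x y rewrite splitAt-join m m (inj₁ x) | splitAt-join m m (inj₁ y) = refl

  MD-↑ˡ-↑ʳ : ∀ x y → MD M (x ↑ˡ m) (m ↑ʳ y) ≡ M y x + δ x y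
  MD-↑ˡ-↑ʳ x y rewrite splitAt-join m m (inj₁ x) | splitAt-join m m (inj₂ y) = refl

  MD-↑ʳ-↑ˡ : ∀ x y → MD M (m ↑ʳ x) (y ↑ˡ m) ≡ M x y + δ x y
  MD-↑ʳ-↑ˡ x y rewrite splitAt-join m m (inj₂ x) | splitAt-join m m (inj₁ y) = refl

  MD-↑ʳ-↑ʳ : ∀ x y → MD M (m ↑ʳ x) (m ↑ʳ y) ≡ M y x
  MD-↑ʳ-↑ʳ x y rewrite splitAt-join m m (inj₂ x) | splitAt-join m m (inj₂ y) = refl

Σ-by-halves : ∀ {m} {f : Fin (m + m) → ℕ} {g₁ g₂ : Fin m → ℕ} →
              (∀ z → f (z ↑ˡ m) ≡ g₁ z) → (∀ z → f (m ↑ʳ z) ≡ g₂ z) →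
              Σ[< m + m ] f ≡ Σ[< m ] g₁ + Σ[< m ] g₂
Σ-by-halves {m} e₁ e₂ = trans (Σ-split m m _) (cong₂ _+_ (Σ-cong e₁) (Σ-cong e₂))

·-by-halves : ∀ {m} (M N : Mat (m + m)) {i j} {f₁ g₁ f₂ g₂ : Fin m → ℕ} →
              (∀ z → M i (z ↑ˡ m) ≡ f₁ z) → (∀ z → N (z ↑ˡ m) j ≡ g₁ z) →
              (∀ z → M i (m ↑ʳ z) ≡ f₂ z) → (∀ z → N (m ↑ʳ z) j ≡ g₂ z) →
              (M · N) i j ≡ Σ[< m ] (λ z → f₁ z * g₁ z) + Σ[< m ] (λ z → f₂ z * g₂ z)
·-by-halves M N e₁ e₂ e₃ e₄ =
  Σ-by-halves (λ z → cong₂ _*_ (e₁ z) (e₂ z)) (λ z → cong₂ _*_ (e₃ z) (e₄ z))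

summand₁≡0∨1 : ∀ a b c → a + b + c ≡ 1 → a ≡ 0 ⊎ a ≡ 1
summand₁≡0∨1 a b c e = n≤1⇒n≡0∨n≡1 (subst (a ≤_) e (≤-trans (m≤m+n a b) (m≤m+n (a + b) c)))

summand₂≡0∨1 : ∀ a b c → a + b + c ≡ 1 → b ≡ 0 ⊎ b ≡ 1
summand₂≡0∨1 a b c e = n≤1⇒n≡0∨n≡1 (subst (b ≤_) e (≤-trans (m≤n+m b a) (m≤m+n (a + b) c)))

a+a+1+b≡1⇒a≡0 : ∀ a b → a + a + 1 + b ≡ 1 → a ≡ 0
a+a+1+b≡1⇒a≡0 zero    b e = refl
a+a+1+b≡1⇒a≡0 (suc a) b e
  with m+n≡0⇒n≡0 a (m+n≡0⇒m≡0 _ (m+n≡0⇒m≡0 _ (suc-injective e)))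
... | ()

dsrg-rhs-λ≡μ : ∀ k d v → d ≡ 0 ⊎ d ≡ 1 → v ≡ 0 ⊎ v ≡ 1 → (d ≡ 1 → v ≡ 0) →
               k + d ≡ (k + 1) * d + k * v + k * ((1 ∸ d) ∸ v)
dsrg-rhs-λ≡μ k .0 .0 (inj₁ refl) (inj₁ refl) _ =
  solve 1 (λ k → k :+ con 0 := (k :+ con 1) :* con 0 :+ k :* con 0 :+ k :* con 1) refl k
dsrg-rhs-λ≡μ k .0 .1 (inj₁ refl) (inj₂ refl) _ =
  solve 1 (λ k → k :+ con 0 := (k :+ con 1) :* con 0 :+ k :* con 1 :+ k :* con 0) refl k
dsrg-rhs-λ≡μ k .1 v  (inj₂ refl) _ noLoop rewrite noLoop refl =
  solve 1 (λ k → k :+ con 1 := (k :+ con 1) :* con 1 :+ k :* con 0 :+ k :* con 0) refl k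

IsDSRG-cast : ∀ {n n′ k t λ′ μ} {M : Mat n′} (e : n ≡ n′) → IsDSRG n′ k t λ′ μ M →
              IsDSRG n k t λ′ μ (λ i j → M (cast e i) (cast e j))
IsDSRG-cast {n} {n′} {k} {t} {λ′} {μ} {M} e dsrg = record
  { zeroOne = λ i j → zeroOne (cast e i) (cast e j)
  ; noLoops = λ i → noLoops (cast e i)
  ; square  = λ i j →
      trans (Σ-cast e (λ l → M (cast e i) l * M l (cast e j)))
     (trans (square (cast e i) (cast e j))
            (cong (λ d → t * d + λ′ * M (cast e i) (cast e j) + μ * ((1 ∸ d) ∸ M (cast e i) (cast e j)))
                  (δ-cast e i j)))
  ; rowSum  = λ i → trans (Σ-cast e (M (cast e i))) (rowSum (cast e i))
  ; colSum  = λ j → trans (Σ-cast e (λ l → M l (cast e j))) (colSum (cast e j))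
  }
  where open IsDSRG dsrg

record IsAntipodal {m : ℕ} (k : ℕ) (D : Mat m) : Set where
  field
    antipode             : Fin m → Fin m
    antipode-involutive  : ∀ x → antipode (antipode x) ≡ x
    partition            : ∀ x z → D x z + D z x + δ x z + δ (antipode x) z ≡ 1
    antipode-out         : ∀ x y → D (antipode x) y ≡ D y x
    rowSum               : ∀ x → Σ[< m ] (D x) ≡ k
    colSum               : ∀ y → Σ[< m ] (λ x → D x y) ≡ k

module IsAntipodalProperties {m k : ℕ} {D : Mat m} (antipodal : IsAntipodal k D) where
  open IsAntipodal antipodal
  open ≡-Reasoning

  antipode-in : ∀ x y → D y (antipode x) ≡ D x y
  antipode-in x y = trans (sym (antipode-out (antipode x) y))
                          (cong (λ w → D w y) (antipode-involutive x))

  -- Row x of the upper half of M(D) is [D x, Dᵀ x + δ x], of the lower half [D x + δ x, Dᵀ x];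
  -- these add up the two pieces.
  upperRow lowerRow : Fin m → Fin m → ℕ
  upperRow x z = D x z + (D z x + δ x z)
  lowerRow x z = D x z + δ x z + D z x

  partition-upper : ∀ x z → upperRow x z + δ (antipode x) z ≡ 1
  partition-upper x z =
    trans (cong (_+ δ (antipode x) z) (sym (+-assoc (D x z) _ _))) (partition x z)

  partition-lower : ∀ x z → lowerRow x z + δ (antipode x) z ≡ 1
  partition-lower x z =
    trans (cong (_+ δ (antipode x) z)
                (solve 3 (λ a b c → a :+ c :+ b := a :+ b :+ c) refl (D x z) (D z x) (δ x z)))
          (partition x z)

  D≡0∨1 : ∀ x z → D x z ≡ 0 ⊎ D x z ≡ 1
  D≡0∨1 x z = summand₁≡0∨1 (D x z) _ _ (partition-upper x z)

  Dᵀ+I≡0∨1 : ∀ x z → D z x + δ x z ≡ 0 ⊎ D z x + δ x z ≡ 1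
  Dᵀ+I≡0∨1 x z = summand₂≡0∨1 (D x z) _ _ (partition-upper x z)

  D+I≡0∨1 : ∀ x z → D x z + δ x z ≡ 0 ⊎ D x z + δ x z ≡ 1
  D+I≡0∨1 x z = summand₁≡0∨1 (D x z + δ x z) _ _ (partition-lower x z)

  D-irreflexive : ∀ x → D x x ≡ 0
  D-irreflexive x = a+a+1+b≡1⇒a≡0 (D x x) (δ (antipode x) x)
    (trans (cong (λ d → D x x + D x x + d + δ (antipode x) x) (sym (δ-refl x))) (partition x x))

  complement-col : ∀ {r : Fin m → ℕ} x y → (∀ z → r z + δ (antipode x) z ≡ 1) →
                   Σ[< m ] (λ z → r z * D z y) + D y x ≡ k
  complement-col {r} x y r+δ≡1 = begin
    Σ[< m ] (λ z → r z * D z y) + D y x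
      ≡⟨ cong (Σ[< m ] (λ z → r z * D z y) +_) (sym (antipode-out x y)) ⟩
    Σ[< m ] (λ z → r z * D z y) + D (antipode x) y
      ≡⟨ Σ-complement r (antipode x) (λ z → D z y) r+δ≡1 ⟩
    Σ[< m ] (λ z → D z y)
      ≡⟨ colSum y ⟩
    k ∎

  complement-row : ∀ {r : Fin m → ℕ} x y → (∀ z → r z + δ (antipode x) z ≡ 1) →
                   Σ[< m ] (λ z → r z * D y z) + D x y ≡ k
  complement-row {r} x y r+δ≡1 = begin
    Σ[< m ] (λ z → r z * D y z) + D x y
      ≡⟨ cong (Σ[< m ] (λ z → r z * D y z) +_) (sym (antipode-in x y)) ⟩
    Σ[< m ] (λ z → r z * D y z) + D y (antipode x)
      ≡⟨ Σ-complement r (antipode x) (D y) r+δ≡1 ⟩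
    Σ[< m ] (D y)
      ≡⟨ rowSum y ⟩
    k ∎

  private
    M : Mat (m + m)
    M = MD D

  square-↑ˡ-↑ˡ : ∀ x y → (M · M) (x ↑ˡ m) (y ↑ˡ m) ≡ k + δ x y
  square-↑ˡ-↑ˡ x y = begin
    (M · M) (x ↑ˡ m) (y ↑ˡ m)
      ≡⟨ ·-by-halves M M (MD-↑ˡ-↑ˡ D x) (λ z → MD-↑ˡ-↑ˡ D z y)
                         (MD-↑ˡ-↑ʳ D x) (λ z → MD-↑ʳ-↑ˡ D z y) ⟩
    Σ[< m ] (λ z → D x z * D z y) + Σ[< m ] (λ z → (D z x + δ x z) * (D z y + δ z y))
      ≡⟨ Σ-collectʳ (D x) (λ z → D z x + δ x z) (λ z → D z y) (λ z → δ z y) ⟩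
    Σ[< m ] (λ z → upperRow x z * D z y) + Σ[< m ] (λ z → (D z x + δ x z) * δ z y)
      ≡⟨ cong (Σ[< m ] (λ z → upperRow x z * D z y) +_) (Σ-δʳ y (λ z → D z x + δ x z)) ⟩
    Σ[< m ] (λ z → upperRow x z * D z y) + (D y x + δ x y)
      ≡⟨ sym (+-assoc _ (D y x) (δ x y)) ⟩
    Σ[< m ] (λ z → upperRow x z * D z y) + D y x + δ x y
      ≡⟨ cong (_+ δ x y) (complement-col x y (partition-upper x)) ⟩
    k + δ x y ∎

  square-↑ˡ-↑ʳ : ∀ x y → (M · M) (x ↑ˡ m) (m ↑ʳ y) ≡ k
  square-↑ˡ-↑ʳ x y = begin
    (M · M) (x ↑ˡ m) (m ↑ʳ y)
      ≡⟨ ·-by-halves M M (MD-↑ˡ-↑ˡ D x) (λ z → MD-↑ˡ-↑ʳ D z y)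
                         (MD-↑ˡ-↑ʳ D x) (λ z → MD-↑ʳ-↑ʳ D z y) ⟩
    Σ[< m ] (λ z → D x z * (D y z + δ z y)) + Σ[< m ] (λ z → (D z x + δ x z) * D y z)
      ≡⟨ Σ-collectˡ (D x) (λ z → D z x + δ x z) (D y) (λ z → δ z y) ⟩
    Σ[< m ] (λ z → upperRow x z * D y z) + Σ[< m ] (λ z → D x z * δ z y)
      ≡⟨ cong (Σ[< m ] (λ z → upperRow x z * D y z) +_) (Σ-δʳ y (D x)) ⟩
    Σ[< m ] (λ z → upperRow x z * D y z) + D x y
      ≡⟨ complement-row x y (partition-upper x) ⟩
    k ∎

  square-↑ʳ-↑ˡ : ∀ x y → (M · M) (m ↑ʳ x) (y ↑ˡ m) ≡ k
  square-↑ʳ-↑ˡ x y = begin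
    (M · M) (m ↑ʳ x) (y ↑ˡ m)
      ≡⟨ ·-by-halves M M (MD-↑ʳ-↑ˡ D x) (λ z → MD-↑ˡ-↑ˡ D z y)
                         (MD-↑ʳ-↑ʳ D x) (λ z → MD-↑ʳ-↑ˡ D z y) ⟩
    Σ[< m ] (λ z → (D x z + δ x z) * D z y) + Σ[< m ] (λ z → D z x * (D z y + δ z y))
      ≡⟨ Σ-collectʳ (λ z → D x z + δ x z) (λ z → D z x) (λ z → D z y) (λ z → δ z y) ⟩
    Σ[< m ] (λ z → lowerRow x z * D z y) + Σ[< m ] (λ z → D z x * δ z y)
      ≡⟨ cong (Σ[< m ] (λ z → lowerRow x z * D z y) +_) (Σ-δʳ y (λ z → D z x)) ⟩
    Σ[< m ] (λ z → lowerRow x z * D z y) + D y x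
      ≡⟨ complement-col x y (partition-lower x) ⟩
    k ∎

  square-↑ʳ-↑ʳ : ∀ x y → (M · M) (m ↑ʳ x) (m ↑ʳ y) ≡ k + δ x y
  square-↑ʳ-↑ʳ x y = begin
    (M · M) (m ↑ʳ x) (m ↑ʳ y)
      ≡⟨ ·-by-halves M M (MD-↑ʳ-↑ˡ D x) (λ z → MD-↑ˡ-↑ʳ D z y)
                         (MD-↑ʳ-↑ʳ D x) (λ z → MD-↑ʳ-↑ʳ D z y) ⟩
    Σ[< m ] (λ z → (D x z + δ x z) * (D y z + δ z y)) + Σ[< m ] (λ z → D z x * D y z)
      ≡⟨ Σ-collectˡ (λ z → D x z + δ x z) (λ z → D z x) (D y) (λ z → δ z y) ⟩
    Σ[< m ] (λ z → lowerRow x z * D y z) + Σ[< m ] (λ z → (D x z + δ x z) * δ z y)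
      ≡⟨ cong (Σ[< m ] (λ z → lowerRow x z * D y z) +_) (Σ-δʳ y (λ z → D x z + δ x z)) ⟩
    Σ[< m ] (λ z → lowerRow x z * D y z) + (D x y + δ x y)
      ≡⟨ sym (+-assoc _ (D x y) (δ x y)) ⟩
    Σ[< m ] (λ z → lowerRow x z * D y z) + D x y + δ x y
      ≡⟨ cong (_+ δ x y) (complement-row x y (partition-lower x)) ⟩
    k + δ x y ∎

MD-isDSRG : ∀ {m k} {D : Mat m} → IsAntipodal k D →
            IsDSRG (m + m) (2 * k + 1) (k + 1) k k (MD D)
MD-isDSRG {m} {k} {D} antipodal = record
  { zeroOne = M-zeroOne
  ; noLoops = M-noLoops
  ; square  = λ i j → trans (M²≡kJ+I i j)
      (dsrg-rhs-λ≡μ k (δ i j) (M i j) (δ≡0∨1 i j) (M-zeroOne i j)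
                    (λ δ≡1 → subst (λ j → M i j ≡ 0) (δ≡1⇒≡ δ≡1) (M-noLoops i)))
  ; rowSum  = M-rowSum
  ; colSum  = M-colSum
  }
  where
  open IsAntipodal antipodal
  open IsAntipodalProperties antipodal

  M : Mat (m + m)
  M = MD D

  M-zeroOne : ∀ i j → M i j ≡ 0 ⊎ M i j ≡ 1
  M-zeroOne i j with halves m m i | halves m m j
  ... | left x  | left y  rewrite MD-↑ˡ-↑ˡ D x y = D≡0∨1 x y
  ... | left x  | right y rewrite MD-↑ˡ-↑ʳ D x y = Dᵀ+I≡0∨1 x y
  ... | right x | left y  rewrite MD-↑ʳ-↑ˡ D x y = D+I≡0∨1 x y
  ... | right x | right y rewrite MD-↑ʳ-↑ʳ D x y = D≡0∨1 y x

  M-noLoops : ∀ i → M i i ≡ 0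
  M-noLoops i with halves m m i
  ... | left x  = trans (MD-↑ˡ-↑ˡ D x x) (D-irreflexive x)
  ... | right x = trans (MD-↑ʳ-↑ʳ D x x) (D-irreflexive x)

  M²≡kJ+I : ∀ i j → (M · M) i j ≡ k + δ i j
  M²≡kJ+I i j with halves m m i | halves m m j
  ... | left x  | left y  = trans (square-↑ˡ-↑ˡ x y) (cong (k +_) (sym (δ-↑ˡ m x y)))
  ... | left x  | right y = trans (square-↑ˡ-↑ʳ x y)
                                  (sym (trans (cong (k +_) (δ-↑ˡ-↑ʳ x y)) (+-identityʳ k)))
  ... | right x | left y  = trans (square-↑ʳ-↑ˡ x y)
                                  (sym (trans (cong (k +_) (δ-↑ʳ-↑ˡ y x)) (+-identityʳ k)))
  ... | right x | right y = trans (square-↑ʳ-↑ʳ x y) (cong (k +_) (sym (δ-↑ʳ m x y)))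

  k+[k+1]≡2k+1 : k + (k + 1) ≡ 2 * k + 1
  k+[k+1]≡2k+1 = solve 1 (λ k → k :+ (k :+ con 1) := con 2 :* k :+ con 1) refl k

  [k+1]+k≡2k+1 : k + 1 + k ≡ 2 * k + 1
  [k+1]+k≡2k+1 = solve 1 (λ k → (k :+ con 1) :+ k := con 2 :* k :+ con 1) refl k

  Σ[f+g]≡k+1 : ∀ {f g : Fin m → ℕ} → Σ[< m ] f ≡ k → Σ[< m ] g ≡ 1 →
              Σ[< m ] (λ z → f z + g z) ≡ k + 1
  Σ[f+g]≡k+1 {f} {g} Σf≡k Σg≡1 = trans (Σ-distrib-+ f g) (cong₂ _+_ Σf≡k Σg≡1)

  M-rowSum : ∀ i → Σ[< m + m ] (M i) ≡ 2 * k + 1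
  M-rowSum i with halves m m i
  ... | left x  = trans (Σ-by-halves (MD-↑ˡ-↑ˡ D x) (MD-↑ˡ-↑ʳ D x))
                        (trans (cong₂ _+_ (rowSum x) (Σ[f+g]≡k+1 (colSum x) (Σ-δ x))) k+[k+1]≡2k+1)
  ... | right x = trans (Σ-by-halves (MD-↑ʳ-↑ˡ D x) (MD-↑ʳ-↑ʳ D x))
                        (trans (cong₂ _+_ (Σ[f+g]≡k+1 (rowSum x) (Σ-δ x)) (colSum x)) [k+1]+k≡2k+1)

  M-colSum : ∀ j → Σ[< m + m ] (λ i → M i j) ≡ 2 * k + 1
  M-colSum j with halves m m j
  ... | left y  = trans (Σ-by-halves (λ z → MD-↑ˡ-↑ˡ D z y) (λ z → MD-↑ʳ-↑ˡ D z y))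
                        (trans (cong₂ _+_ (colSum y) (Σ[f+g]≡k+1 (colSum y) (Σ-δᵀ y))) k+[k+1]≡2k+1)
  ... | right y = trans (Σ-by-halves (λ z → MD-↑ˡ-↑ʳ D z y) (λ z → MD-↑ʳ-↑ʳ D z y))
                        (trans (cong₂ _+_ (Σ[f+g]≡k+1 (rowSum y) (Σ-δᵀ y)) (rowSum y)) [k+1]+k≡2k+1)

swapHalves : ∀ n → Fin (n + n) → Fin (n + n)
swapHalves n = join n n ∘ swap ∘ splitAt n

swapHalves-join : ∀ n (s : Fin n ⊎ Fin n) → swapHalves n (join n n s) ≡ join n n (swap s)
swapHalves-join n s = cong (join n n ∘ swap) (splitAt-join n n s)

swapHalves-involutive : ∀ n (i : Fin (n + n)) → swapHalves n (swapHalves n i) ≡ i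
swapHalves-involutive n i = begin
  swapHalves n (join n n (swap (splitAt n i))) ≡⟨ swapHalves-join n (swap (splitAt n i)) ⟩
  join n n (swap (swap (splitAt n i)))         ≡⟨ cong (join n n) (swap-involutive (splitAt n i)) ⟩
  join n n (splitAt n i)                       ≡⟨ join-splitAt n n i ⟩
  i                                            ∎
  where open ≡-Reasoning

join-elim : ∀ {m n} {P : Fin (m + n) → Set} → (∀ s → P (join m n s)) → ∀ i → P i
join-elim {m} {n} {P} p i = subst P (join-splitAt m n i) (p (splitAt m i))

join-elim₂ : ∀ {m n} {P : Fin (m + n) → Fin (m + n) → Set} →
             (∀ s t → P (join m n s) (join m n t)) → ∀ i j → P i j
join-elim₂ {m} {n} {P} p i j =
  join-elim {P = λ i → P i j} (λ s → join-elim {P = P (join m n s)} (p s) j) i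

δ⊎ : ∀ {m n} → Fin m ⊎ Fin n → Fin m ⊎ Fin n → ℕ
δ⊎ (inj₁ a) (inj₁ b) = δ a b
δ⊎ (inj₂ a) (inj₂ b) = δ a b
δ⊎ _        _        = 0

δ-join : ∀ {m n} (s t : Fin m ⊎ Fin n) → δ (join m n s) (join m n t) ≡ δ⊎ s t
δ-join {n = n} (inj₁ a) (inj₁ b) = δ-↑ˡ n a b
δ-join         (inj₁ a) (inj₂ b) = δ-↑ˡ-↑ʳ a b
δ-join         (inj₂ a) (inj₁ b) = δ-↑ʳ-↑ˡ b a
δ-join {m}     (inj₂ a) (inj₂ b) = δ-↑ʳ m a b

pattern top     = inj₁ zero
pattern upper a = inj₁ (suc a)
pattern mid     = inj₂ zero
pattern lower a = inj₂ (suc a)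

module _ {h : ℕ} (A : Mat h) (tournament : IsTournament A) where

  private
    n : ℕ
    n = suc h

  Node : Set
  Node = Fin n ⊎ Fin n

  D-nodes : Node → Node → ℕ
  D-nodes top       top       = 0
  D-nodes top       (upper b) = 1
  D-nodes top       mid       = 0
  D-nodes top       (lower b) = 0
  D-nodes (upper a) top       = 0
  D-nodes (upper a) (upper b) = A a b
  D-nodes (upper a) mid       = 1
  D-nodes (upper a) (lower b) = A b a
  D-nodes mid       top       = 0
  D-nodes mid       (upper b) = 0
  D-nodes mid       mid       = 0
  D-nodes mid       (lower b) = 1
  D-nodes (lower a) top       = 1
  D-nodes (lower a) (upper b) = A b a
  D-nodes (lower a) mid       = 0
  D-nodes (lower a) (lower b) = A a b

  D-join : ∀ u v → D A (join n n u) (join n n v) ≡ D-nodes u v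
  D-join u v rewrite splitAt-join n n u | splitAt-join n n v with u | v
  ... | top     | top     = refl
  ... | top     | upper b = refl
  ... | top     | mid     = refl
  ... | top     | lower b = refl
  ... | upper a | top     = refl
  ... | upper a | upper b = refl
  ... | upper a | mid     = refl
  ... | upper a | lower b = refl
  ... | mid     | top     = refl
  ... | mid     | upper b = refl
  ... | mid     | mid     = refl
  ... | mid     | lower b = refl
  ... | lower a | top     = refl
  ... | lower a | upper b = refl
  ... | lower a | mid     = refl
  ... | lower a | lower b = refl

  tournament-δ : ∀ a b → A a b + A b a + δ a b ≡ 1
  tournament-δ a b = trans (cong (_+ δ a b) (proj₂ tournament a b)) (m∸n+n≡m (δ≤1 a b))

  tournament-δ-swapped : ∀ a b → A b a + A a b + 0 + δ a b ≡ 1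
  tournament-δ-swapped a b =
    trans (solve 3 (λ x y z → y :+ x :+ con 0 :+ z := x :+ y :+ z) refl (A a b) (A b a) (δ a b))
          (tournament-δ a b)

  out+in-degree : ∀ a → Σ[< h ] (A a) + Σ[< h ] (λ b → A b a) + 1 ≡ h
  out+in-degree a = begin
    Σ[< h ] (A a) + Σ[< h ] (λ b → A b a) + 1
      ≡⟨ cong₂ _+_ (sym (Σ-distrib-+ (A a) (λ b → A b a))) (sym (Σ-δ a)) ⟩
    Σ[< h ] (λ b → A a b + A b a) + Σ[< h ] (δ a)
      ≡⟨ sym (Σ-distrib-+ (λ b → A a b + A b a) (δ a)) ⟩
    Σ[< h ] (λ b → A a b + A b a + δ a b)
      ≡⟨ Σ-cong (tournament-δ a) ⟩
    Σ[< h ] (λ _ → 1)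
      ≡⟨ Σ-one h ⟩
    h ∎
    where open ≡-Reasoning

  D-nodes-partition : ∀ u v → D-nodes u v + D-nodes v u + δ⊎ u v + δ⊎ (swap u) v ≡ 1
  D-nodes-partition top       top       = refl
  D-nodes-partition top       (upper b) = refl
  D-nodes-partition top       mid       = refl
  D-nodes-partition top       (lower b) = refl
  D-nodes-partition (upper a) top       = refl
  D-nodes-partition (upper a) (upper b) = trans (+-identityʳ _) (tournament-δ a b)
  D-nodes-partition (upper a) mid       = refl
  D-nodes-partition (upper a) (lower b) = tournament-δ-swapped a b
  D-nodes-partition mid       top       = refl
  D-nodes-partition mid       (upper b) = refl
  D-nodes-partition mid       mid       = refl
  D-nodes-partition mid       (lower b) = refl
  D-nodes-partition (lower a) top       = refl
  D-nodes-partition (lower a) (upper b) = tournament-δ-swapped a b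
  D-nodes-partition (lower a) mid       = refl
  D-nodes-partition (lower a) (lower b) = trans (+-identityʳ _) (tournament-δ a b)

  D-nodes-antipode : ∀ u v → D-nodes (swap u) v ≡ D-nodes v u
  D-nodes-antipode top       top       = refl
  D-nodes-antipode top       (upper b) = refl
  D-nodes-antipode top       mid       = refl
  D-nodes-antipode top       (lower b) = refl
  D-nodes-antipode (upper a) top       = refl
  D-nodes-antipode (upper a) (upper b) = refl
  D-nodes-antipode (upper a) mid       = refl
  D-nodes-antipode (upper a) (lower b) = refl
  D-nodes-antipode mid       top       = refl
  D-nodes-antipode mid       (upper b) = refl
  D-nodes-antipode mid       mid       = refl
  D-nodes-antipode mid       (lower b) = refl
  D-nodes-antipode (lower a) top       = refl
  D-nodes-antipode (lower a) (upper b) = refl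
  D-nodes-antipode (lower a) mid       = refl
  D-nodes-antipode (lower a) (lower b) = refl

  D-nodes-rowSum : ∀ u → Σ[< n ] (D-nodes u ∘ inj₁) + Σ[< n ] (D-nodes u ∘ inj₂) ≡ h
  D-nodes-rowSum top       = trans (cong₂ _+_ (Σ-one h) (Σ-zero h)) (+-identityʳ h)
  D-nodes-rowSum (upper a) =
    trans (solve 2 (λ o i → o :+ (con 1 :+ i) := o :+ i :+ con 1) refl
                   (Σ[< h ] (A a)) (Σ[< h ] (λ b → A b a)))
          (out+in-degree a)
  D-nodes-rowSum mid       = cong₂ _+_ (Σ-zero h) (Σ-one h)
  D-nodes-rowSum (lower a) =
    trans (solve 2 (λ o i → con 1 :+ i :+ o := o :+ i :+ con 1) refl
                   (Σ[< h ] (A a)) (Σ[< h ] (λ b → A b a)))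
          (out+in-degree a)

  D-nodes-colSum : ∀ v → Σ[< n ] (λ a → D-nodes (inj₁ a) v) + Σ[< n ] (λ a → D-nodes (inj₂ a) v) ≡ h
  D-nodes-colSum top       = cong₂ _+_ (Σ-zero h) (Σ-one h)
  D-nodes-colSum (upper b) =
    trans (solve 2 (λ o i → con 1 :+ i :+ o := o :+ i :+ con 1) refl
                   (Σ[< h ] (A b)) (Σ[< h ] (λ a → A a b)))
          (out+in-degree b)
  D-nodes-colSum mid       = trans (cong₂ _+_ (Σ-one h) (Σ-zero h)) (+-identityʳ h)
  D-nodes-colSum (lower b) =
    trans (solve 2 (λ o i → o :+ (con 1 :+ i) := o :+ i :+ con 1) refl
                   (Σ[< h ] (A b)) (Σ[< h ] (λ a → A a b)))
          (out+in-degree b)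

  D-isAntipodal : IsAntipodal h (D A)
  D-isAntipodal = record
    { antipode            = swapHalves n
    ; antipode-involutive = swapHalves-involutive n
    ; partition           = join-elim₂ partition-join
    ; antipode-out        = join-elim₂ antipode-out-join
    ; rowSum              = join-elim (λ u →
        trans (Σ-by-halves {f = D A (join n n u)} (λ z → D-join u (inj₁ z)) (λ z → D-join u (inj₂ z))) (D-nodes-rowSum u))
    ; colSum              = join-elim (λ v →
        trans (Σ-by-halves {f = λ x → D A x (join n n v)} (λ z → D-join (inj₁ z) v) (λ z → D-join (inj₂ z) v)) (D-nodes-colSum v))
    }
    where
    partition-join : ∀ u v → D A (join n n u) (join n n v) + D A (join n n v) (join n n u)
                             + δ (join n n u) (join n n v) + δ (swapHalves n (join n n u)) (join n n v) ≡ 1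
    partition-join u v rewrite D-join u v | D-join v u | δ-join u v | swapHalves-join n u
                             | δ-join (swap u) v = D-nodes-partition u v

    antipode-out-join : ∀ u v → D A (swapHalves n (join n n u)) (join n n v) ≡ D A (join n n v) (join n n u)
    antipode-out-join u v rewrite swapHalves-join n u | D-join (swap u) v | D-join v u =
      D-nodes-antipode u v

lemma9 : (h : ℕ) (A : Mat h) → IsTournament A → IsRegular A →
    IsDSRG (4 * suc h) (2 * h + 1) (h + 1) h h (M4 A)
lemma9 h A tournament _ = IsDSRG-cast (order-eq h) (MD-isDSRG (D-isAntipodal A tournament))
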